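{- Let $H$ be a square-free graph whose odd-girth is $\ell$ (finite). If $H$ contains an edge that lies in an odd number of cycles of length $\ell$, then $H$ has a hardness gadget.
   Context: Graphs are finite, simple, undirected, loopless; square-free means no 4-cycle as a subgraph; the odd-girth is the length of a shortest odd cycle. A partially $H$-labelled graph $J=(G,\tau)$ is a graph $G$ with a partial function $\tau:V(G)\to V(H)$; $J$ is connected if $G$ is. A homomorphism from $J$ to $H$ is a graph homomorphism $\sigma:G\to H$ with $\sigma(v)=\tau(v)$ on $\mathrm{dom}(\tau)$; $\mathrm{Hom}((J,y),(H,a))$ denotes those also mapping the distinguished vertex $y$ to $a$, and $\mathrm{Hom}((J,y,z),(H,a,b))$ those mapping $y\mapsto a$, $z\mapsto b$. A hardness gadget for $H$ is a tuple $(i,s,(J_1,y),(J_2,z),(J_3,y,z))$ with $i,s\in V(H)$ and $J_1,J_2,J_3$ connected partially $H$-labelled graphs with distinguished vertices $y$ in $J_1$, $z$ in $J_2$, and $y,z$ in $J_3$, such that, with $\Omega_y=\{a:|\mathrm{Hom}((J_1,y),(H,a))|\text{ odd}\}$, $\Omega_z=\{b:|\mathrm{Hom}((J_2,z),(H,b))|\text{ odd}\}$, $\Sigma_{a,b}=\mathrm{Hom}((J_3,y,z),(H,a,b))$: (1) $|\Omega_y|$ even and $i\in\Omega_y$; (2) $|\Omega_z|$ even and $s\in\Omega_z$; (3) $|\Sigma_{o,x}|$ even for all $o\in\Omega_y\setminus\{i\}$, $x\in\Omega_z\setminus\{s\}$; (4) $|\Sigma_{i,s}|$ odd and $|\Sigma_{o,s}|,|\Sigma_{i,x}|$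 odd for all such $o,x$. -}

module Defs where

open import Data.Nat using (ℕ; zero; suc; _+_; _≤_; _<_; _%_)
open import Data.Nat.Properties using ()
open import Data.Bool using (Bool; true; false; _∧_; _∨_; not; T; if_then_else_)
open import Data.Fin using (Fin; _≟_) renaming (zero to fz; suc to fs)
open import Data.Maybe using (Maybe; just; nothing)
open import Data.List using (List; []; _∷_; map; concatMap; length; take; _++_)
open import Data.Bool.ListAction using (any; all)
open import Data.Vec.Functional using (toList) renaming (_∷_ to _∷ᶠ_)
open import Data.Product using (Σ; ∃; _×_; _,_)
open import Relation.Nullary using (¬_)
open import Relation.Nullary.Decidable using (⌊_⌋)
open import Relation.Binary.PropositionalEquality using (_≡_)

record Graph : Set where
  field
    n      : ℕ
    adj    : Fin n → Fin n → Bool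
    sym    : ∀ i j → adj i j ≡ adj j i
    irrefl : ∀ i → adj i i ≡ false
open Graph public

V : Graph → Set
V G = Fin (n G)

allFin : (m : ℕ) → List (Fin m)
allFin zero = []
allFin (suc m) = fz ∷ map fs (allFin m)

allFuns : (m k : ℕ) → List (Fin m → Fin k)
allFuns zero k = (λ ()) ∷ []
allFuns (suc m) k = concatMap (λ a → map (λ f → a ∷ᶠ f) (allFuns m k)) (allFin k)

count : {A : Set} → (A → Bool) → List A → ℕ
count p [] = 0
count p (x ∷ xs) = if p x then suc (count p xs) else count p xs

Odd : ℕ → Set
Odd m = m % 2 ≡ 1

Even : ℕ → Set
Even m = m % 2 ≡ 0

_==_ : {k : ℕ} → Fin k → Fin k → Bool
a == b = ⌊ a ≟ b ⌋

distinct : {k : ℕ} → List (Fin k) → Bool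
distinct [] = true
distinct (x ∷ xs) = not (any (x ==_) xs) ∧ distinct xs

pathAdj : (G : Graph) → List (V G) → Bool
pathAdj G (a ∷ b ∷ rest) = adj G a b ∧ pathAdj G (b ∷ rest)
pathAdj G _ = true

atLeast3 : {A : Set} → List A → Bool
atLeast3 (_ ∷ _ ∷ _ ∷ _) = true
atLeast3 _ = false

isCycleSeq : (G : Graph) → List (V G) → Bool
isCycleSeq G xs = atLeast3 xs ∧ distinct xs ∧ pathAdj G (xs ++ take 1 xs)

HasCycle : Graph → ℕ → Set
HasCycle G k = Σ (Fin k → V G) λ f → T (isCycleSeq G (toList f))

SquareFree : Graph → Set
SquareFree G = ¬ HasCycle G 4

data OddN : ℕ → Set where
  one  : OddN 1
  ss   : ∀ {m} → OddN m → OddN (suc (suc m))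

OddGirth : Graph → ℕ → Set
OddGirth G ℓ = OddN ℓ × HasCycle G ℓ × (∀ k → OddN k → k < ℓ → ¬ HasCycle G k)

startsWith : {k : ℕ} → Fin k → Fin k → List (Fin k) → Bool
startsWith u v (a ∷ b ∷ _) = (a == u) ∧ (b == v)
startsWith u v _ = false

-- Number of cycles of length ℓ in G containing the edge uv.  Each such
-- cycle corresponds to exactly one cyclic sequence x₀ … x_{ℓ-1} with
-- x₀ = u, x₁ = v (traverse the cycle starting along the edge u → v).
cyclesThrough : (G : Graph) → V G → V G → ℕ → ℕ
cyclesThrough G u v ℓ =
  count (λ f → startsWith u v (toList f) ∧ isCycleSeq G (toList f)) (allFuns ℓ (n G))

record PLGraph (H : Graph) : Set where
  field
    G   : Graph
    τ   : V G → Maybe (V H)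
open PLGraph public

Walk : (G : Graph) → ℕ → V G → V G → Set
Walk G k u v = Σ (Fin (suc k) → V G) λ w →
  T (pathAdj G (toList w)) × (w fz ≡ u) × (w (Data.Fin.fromℕ k) ≡ v)

Connected : Graph → Set
Connected G = ∀ u v → ∃ λ k → Walk G k u v

labelOK : {H : Graph} (J : PLGraph H) → (V (G J) → V H) → V (G J) → Bool
labelOK {H} J σ x with τ J x
... | nothing = true
... | just a  = σ x == a

isHom : {H : Graph} (J : PLGraph H) → (V (G J) → V H) → Bool
isHom {H} J σ =
  all (λ i → all (λ j → not (adj (G J) i j) ∨ adj H (σ i) (σ j)) (allFin (n (G J))))
      (allFin (n (G J)))
  ∧ all (labelOK J σ) (allFin (n (G J)))

hom1 : {H : Graph} (J : PLGraph H) → V (G J) → V H → ℕ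
hom1 {H} J y a = count (λ σ → isHom J σ ∧ (σ y == a)) (allFuns (n (G J)) (n H))

hom2 : {H : Graph} (J : PLGraph H) → V (G J) → V (G J) → V H → V H → ℕ
hom2 {H} J y z a b =
  count (λ σ → isHom J σ ∧ (σ y == a) ∧ (σ z == b)) (allFuns (n (G J)) (n H))

oddB : ℕ → Bool
oddB m = (m % 2) Data.Nat.≡ᵇ 1

omegaSize : {H : Graph} (J : PLGraph H) → V (G J) → ℕ
omegaSize {H} J y = count (λ a → oddB (hom1 J y a)) (allFin (n H))

record HardnessGadget (H : Graph) : Set where
  field
    i s : V H
    J₁ J₂ J₃ : PLGraph H
    y₁ : V (G J₁)
    z₂ : V (G J₂)
    y₃ z₃ : V (G J₃)
    conn₁ : Connected (G J₁)
    conn₂ : Connected (G J₂)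
    conn₃ : Connected (G J₃)
    Ωy-even : Even (omegaSize J₁ y₁)
    i∈Ωy    : Odd (hom1 J₁ y₁ i)
    Ωz-even : Even (omegaSize J₂ z₂)
    s∈Ωz    : Odd (hom1 J₂ z₂ s)
    cond3 : ∀ o x → Odd (hom1 J₁ y₁ o) → ¬ o ≡ i → Odd (hom1 J₂ z₂ x) → ¬ x ≡ s →
            Even (hom2 J₃ y₃ z₃ o x)
    cond4-is : Odd (hom2 J₃ y₃ z₃ i s)
    cond4-os : ∀ o → Odd (hom1 J₁ y₁ o) → ¬ o ≡ i → Odd (hom2 J₃ y₃ z₃ o s)
    cond4-ix : ∀ x → Odd (hom1 J₂ z₂ x) → ¬ x ≡ s → Odd (hom2 J₃ y₃ z₃ i x)

module Submission where

-- Take for J₁ and J₂ the ℓ-cycle with vertex 0 pinned to u, resp. v, and distinguished vertex 1, for J₃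
-- a single unlabelled edge, and i = v, s = u. Since ℓ is the odd girth, a homomorphism from the ℓ-cycle
-- is injective, i.e. an ℓ-cycle of H; so |Hom((J₁,1),(H,v))| is the number of ℓ-cycles through uv, which
-- is odd, and reflecting the cycle in the edge 01 gives the same for J₂ and u. The reflection fixing 0
-- is an involution on Hom(J₁,H) without fixed points (it flips the edge opposite 0), so
-- Σ_a |Hom((J₁,1),(H,a))| = |Hom(J₁,H)| is even, hence so is |Ω_y|; likewise |Ω_z|. A positive count
-- makes every o ∈ Ω_y a neighbour of u and every x ∈ Ω_z a neighbour of v, so for o ≠ v and x ≠ u an
-- edge ox would close the 4-cycle u v x o: square-freeness gives (3), and (4) is adjacency in H.

open import Defs hiding (sym)
open import Data.Nat using (ℕ; zero; suc; _+_; _*_; _∸_; _%_; _≤_; _<_; _≤?_; _<?_; z≤n; s≤s)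
import Data.Nat as ℕ
open import Data.Nat.Properties
  using (+-assoc; +-comm; +-suc; +-identityʳ; *-identityʳ; +-cancelˡ-≡; +-cancelˡ-<; +-monoˡ-<; +-monoʳ-≤;
         suc-injective; 1+n≢n; ≤-refl; ≤-trans; ≤-antisym; ≤-pred; <-trans; <⇒≤; <⇒≱; ≤-<-trans; ≰⇒>; ≮⇒≥;
         <-irrefl; n≤1+n; n<1+n; m≤m+n; m≤n+m; m<m+n; m<n+m; m∸n≤m; m+[n∸m]≡n; +-commutativeSemigroup)
open import Data.Nat.ListAction using (sum)
open import Algebra.Properties.CommutativeSemigroup +-commutativeSemigroup using (interchange; x∙yz≈y∙xz)
open import Data.Bool using (Bool; true; false; _∧_; _∨_; _xor_; not; T)
open import Data.Bool.Properties
  using (⇔→≡; ¬-not; not-injective; not-involutive; ∧-assoc; ∧-comm; ∧-identityʳ; ∧-zeroʳ; ∧-conicalˡ; ∧-conicalʳ)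
open import Data.Bool.ListAction using (and; all; any)
open import Data.Fin using (Fin; _≟_; toℕ; fromℕ; fromℕ<; inject₁) renaming (zero to fz; suc to fs)
open import Data.Fin.Properties
  using (toℕ-injective; toℕ-fromℕ; toℕ-fromℕ<; toℕ-inject₁; toℕ<n; fromℕ<-toℕ)
  renaming (suc-injective to fs-injective)
open import Data.List using (List; []; _∷_; [_]; map; concatMap; _++_; length; take; lookup)
open import Data.List.Properties
  using (map-∘; ++-assoc; ++-identityʳ; length-++; length-++-sucʳ; tabulate-lookup; length-tabulate)
open import Data.Maybe using (just; nothing)
open import Data.Product using (Σ; ∃-syntax; _×_; _,_; proj₁; proj₂)
open import Data.Sum using (_⊎_; inj₁; inj₂)
open import Data.Unit using (tt)
open import Data.Empty using (⊥-elim)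
open import Data.Vec.Functional using (toList) renaming (_∷_ to _∷ᶠ_; [] to []ᶠ)
open import Function using (_∘_; _⇔_; mk⇔)
open import Relation.Nullary using (¬_; Dec; yes; no; does)
open import Relation.Nullary.Decidable using (dec-true; dec-false; does-⇔; isYes≗does; ⌊_⌋; _⊎-dec_; _×-dec_)
open import Relation.Binary.PropositionalEquality hiding ([_])

bool→ℕ : Bool → ℕ
bool→ℕ true = 1
bool→ℕ false = 0

≡true⇒T : {b : Bool} → b ≡ true → T b
≡true⇒T refl = tt

does⇒ : {A : Set} (a? : Dec A) → does a? ≡ true → A
does⇒ (yes a) _ = a

module _ {A : Set} where

  count-∷ : (p : A → Bool) (x : A) (xs : List A) → count p (x ∷ xs) ≡ bool→ℕ (p x) + count p xs
  count-∷ p x xs with p x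
  ... | true = refl
  ... | false = refl

  count-++ : (p : A → Bool) (xs ys : List A) → count p (xs ++ ys) ≡ count p xs + count p ys
  count-++ p [] ys = refl
  count-++ p (x ∷ xs) ys = begin
    count p (x ∷ xs ++ ys)                      ≡⟨ count-∷ p x (xs ++ ys) ⟩
    bool→ℕ (p x) + count p (xs ++ ys)           ≡⟨ cong (bool→ℕ (p x) +_) (count-++ p xs ys) ⟩
    bool→ℕ (p x) + (count p xs + count p ys)    ≡⟨ +-assoc (bool→ℕ (p x)) _ _ ⟨
    (bool→ℕ (p x) + count p xs) + count p ys    ≡⟨ cong (_+ count p ys) (count-∷ p x xs) ⟨
    count p (x ∷ xs) + count p ys               ∎
    where open ≡-Reasoning

  count-cong : {p q : A → Bool} → (∀ x → p x ≡ q x) → (xs : List A) → count p xs ≡ count q xs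
  count-cong e [] = refl
  count-cong {p} {q} e (x ∷ xs)
    rewrite count-∷ p x xs | count-∷ q x xs | e x | count-cong e xs = refl

  count-none : {p : A → Bool} → (∀ x → p x ≡ false) → (xs : List A) → count p xs ≡ 0
  count-none e [] = refl
  count-none {p} e (x ∷ xs) rewrite count-∷ p x xs | e x = count-none e xs

  count-const-∧ : (b : Bool) (p : A → Bool) (xs : List A) → count (λ x → b ∧ p x) xs ≡ bool→ℕ b * count p xs
  count-const-∧ true p xs = sym (+-identityʳ _)
  count-const-∧ false p xs = count-none (λ _ → refl) xs

  count-middle : (p : A → Bool) (pre post : List A) (b : A) →
    count p (pre ++ b ∷ post) ≡ bool→ℕ (p b) + count p (pre ++ post)
  count-middle p [] post b = count-∷ p b post
  count-middle p (x ∷ pre) post b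
    rewrite count-∷ p x (pre ++ b ∷ post) | count-∷ p x (pre ++ post) | count-middle p pre post b =
    x∙yz≈y∙xz (bool→ℕ (p x)) (bool→ℕ (p b)) _

  count>0⇒∃ : {p : A → Bool} (xs : List A) → 0 < count p xs → ∃[ x ] p x ≡ true
  count>0⇒∃ {p} (x ∷ xs) pos with p x in px
  ... | true = x , px
  ... | false = count>0⇒∃ xs pos

  sum-map-+ : (g h : A → ℕ) (xs : List A) → sum (map (λ x → g x + h x) xs) ≡ sum (map g xs) + sum (map h xs)
  sum-map-+ g h [] = refl
  sum-map-+ g h (x ∷ xs) rewrite sum-map-+ g h xs = interchange (g x) (h x) _ _

  sum-map-zero : {h : A → ℕ} → (∀ x → h x ≡ 0) → (xs : List A) → sum (map h xs) ≡ 0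
  sum-map-zero e [] = refl
  sum-map-zero e (x ∷ xs) rewrite e x = sum-map-zero e xs

  sum-map-bool→ℕ : (p : A → Bool) (xs : List A) → sum (map (bool→ℕ ∘ p) xs) ≡ count p xs
  sum-map-bool→ℕ p [] = refl
  sum-map-bool→ℕ p (x ∷ xs) rewrite count-∷ p x xs | sum-map-bool→ℕ p xs = refl

  sum-map-cong : {g h : A → ℕ} → (∀ x → g x ≡ h x) → (xs : List A) → sum (map g xs) ≡ sum (map h xs)
  sum-map-cong e [] = refl
  sum-map-cong e (x ∷ xs) = cong₂ _+_ (e x) (sum-map-cong e xs)

module _ {A B : Set} where

  count-map : (p : B → Bool) (f : A → B) (xs : List A) → count p (map f xs) ≡ count (p ∘ f) xs
  count-map p f [] = refl
  count-map p f (x ∷ xs) rewrite count-∷ p (f x) (map f xs) | count-∷ (p ∘ f) x xs | count-map p f xs = refl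

  count-concatMap : (p : B → Bool) (f : A → List B) (xs : List A) →
    count p (concatMap f xs) ≡ sum (map (count p ∘ f) xs)
  count-concatMap p f [] = refl
  count-concatMap p f (x ∷ xs) =
    trans (count-++ p (f x) (concatMap f xs)) (cong (count p (f x) +_) (count-concatMap p f xs))

  sum-count-by-key : (p : A → Bool) (key : A → B → Bool) (bs : List B) →
    (∀ x → count (key x) bs ≡ 1) → (xs : List A) →
    sum (map (λ b → count (λ x → p x ∧ key x b) xs) bs) ≡ count p xs
  sum-count-by-key p key bs unique [] = sum-map-zero (λ _ → refl) bs
  sum-count-by-key p key bs unique (x ∷ xs) = begin
    sum (map (λ b → count (λ y → p y ∧ key y b) (x ∷ xs)) bs)
      ≡⟨ sum-map-cong (λ b → count-∷ (λ y → p y ∧ key y b) x xs) bs ⟩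
    sum (map (λ b → bool→ℕ (p x ∧ key x b) + count (λ y → p y ∧ key y b) xs) bs)
      ≡⟨ sum-map-+ (λ b → bool→ℕ (p x ∧ key x b)) _ bs ⟩
    sum (map (λ b → bool→ℕ (p x ∧ key x b)) bs) + sum (map (λ b → count (λ y → p y ∧ key y b) xs) bs)
      ≡⟨ cong₂ _+_ head (sum-count-by-key p key bs unique xs) ⟩
    bool→ℕ (p x) + count p xs
      ≡⟨ count-∷ p x xs ⟨
    count p (x ∷ xs) ∎
    where
    open ≡-Reasoning
    head : sum (map (λ b → bool→ℕ (p x ∧ key x b)) bs) ≡ bool→ℕ (p x)
    head with p x
    ... | true = trans (sum-map-bool→ℕ (key x) bs) (unique x)
    ... | false = sum-map-zero (λ _ → refl) bs

parity : ℕ → Bool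
parity zero = false
parity (suc m) = not (parity m)

parity-suc-suc : ∀ m → parity (suc (suc m)) ≡ parity m
parity-suc-suc m = not-involutive (parity m)

parity-+ : ∀ m k → parity (m + k) ≡ parity m xor parity k
parity-+ zero k = refl
parity-+ (suc m) k rewrite parity-+ m k with parity m
... | true = not-involutive (parity k)
... | false = refl

%2≡parity : ∀ m → m % 2 ≡ bool→ℕ (parity m)
%2≡parity zero = refl
%2≡parity (suc zero) = refl
%2≡parity (suc (suc m)) rewrite parity-suc-suc m = %2≡parity m

parity⇒Even : ∀ m → parity m ≡ false → Even m
parity⇒Even m e rewrite %2≡parity m | e = refl

oddB≡parity : ∀ m → oddB m ≡ parity m
oddB≡parity m rewrite %2≡parity m with parity m
... | true = refl
... | false = refl

OddN⇒parity : ∀ {m} → OddN m → parity m ≡ true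
OddN⇒parity one = refl
OddN⇒parity (ss {m} o) = trans (parity-suc-suc m) (OddN⇒parity o)

parity⇒OddN : ∀ m → parity m ≡ true → OddN m
parity⇒OddN (suc zero) e = one
parity⇒OddN (suc (suc m)) e = ss (parity⇒OddN m (trans (sym (parity-suc-suc m)) e))

parity-sum : {A : Set} (h : A → ℕ) (xs : List A) → parity (sum (map h xs)) ≡ parity (count (parity ∘ h) xs)
parity-sum h [] = refl
parity-sum h (x ∷ xs)
  rewrite parity-+ (h x) (sum (map h xs)) | count-∷ (parity ∘ h) x xs
        | parity-+ (bool→ℕ (parity (h x))) (count (parity ∘ h) xs) | parity-sum h xs with parity (h x)
... | true = refl
... | false = refl

parity≡false⇒double : ∀ m → parity m ≡ false → ∃[ t ] m ≡ t + t
parity≡false⇒double zero _ = 0 , refl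
parity≡false⇒double (suc (suc m)) e with parity≡false⇒double m (trans (sym (parity-suc-suc m)) e)
... | t , refl = suc t , cong suc (sym (+-suc t t))

Odd⇒>0 : ∀ {m} → Odd m → 0 < m
Odd⇒>0 {suc m} _ = s≤s z≤n

module Multiplicity {A : Set} (_≈ᵇ_ : A → A → Bool)
  (≈-refl : ∀ x → (x ≈ᵇ x) ≡ true)
  (≈-sym : ∀ {x y} → (x ≈ᵇ y) ≡ true → (y ≈ᵇ x) ≡ true)
  (≈-trans : ∀ {x y z} → (x ≈ᵇ y) ≡ true → (y ≈ᵇ z) ≡ true → (x ≈ᵇ z) ≡ true) where

  mult : List A → A → ℕ
  mult xs x = count (x ≈ᵇ_) xs

  Respects : (A → Bool) → Set
  Respects p = ∀ {x y} → (x ≈ᵇ y) ≡ true → p x ≡ p y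

  ≈ᵇ-respects : ∀ x → Respects (x ≈ᵇ_)
  ≈ᵇ-respects x a≈b = ⇔→≡ (mk⇔ (λ x≈a → ≈-trans x≈a a≈b) (λ x≈b → ≈-trans x≈b (≈-sym a≈b)))

  mult-head>0 : ∀ x xs → 0 < mult (x ∷ xs) x
  mult-head>0 x xs rewrite count-∷ (x ≈ᵇ_) x xs | ≈-refl x = s≤s z≤n

  occurrence : (a : A) (xs : List A) → 0 < mult xs a →
    ∃[ pre ] ∃[ b ] ∃[ post ] (xs ≡ pre ++ b ∷ post) × ((a ≈ᵇ b) ≡ true)
  occurrence a (x ∷ xs) pos with a ≈ᵇ x in a≈x
  ... | true = [] , x , xs , refl , a≈x
  ... | false with occurrence a xs pos
  ... | pre , b , post , refl , a≈b = x ∷ pre , b , post , refl , a≈b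

  count-cong-mult : {p : A → Bool} → Respects p → (xs ys : List A) →
    (∀ x → mult xs x ≡ mult ys x) → count p xs ≡ count p ys
  count-cong-mult p-resp [] [] same = refl
  count-cong-mult p-resp [] (b ∷ ys) same with () ← subst (0 <_) (sym (same b)) (mult-head>0 b ys)
  count-cong-mult {p} p-resp (a ∷ xs) ys same
    with occurrence a ys (subst (0 <_) (same a) (mult-head>0 a xs))
  ... | pre , b , post , refl , a≈b = begin
    count p (a ∷ xs)                   ≡⟨ count-∷ p a xs ⟩
    bool→ℕ (p a) + count p xs          ≡⟨ cong₂ (λ u v → bool→ℕ u + v) (p-resp a≈b)
                                                 (count-cong-mult p-resp xs (pre ++ post) same′) ⟩
    bool→ℕ (p b) + count p (pre ++ post) ≡⟨ count-middle p pre post b ⟨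
    count p (pre ++ b ∷ post)          ∎
    where
    open ≡-Reasoning
    same′ : ∀ x → mult xs x ≡ mult (pre ++ post) x
    same′ x = +-cancelˡ-≡ (bool→ℕ (x ≈ᵇ b)) _ _ (begin
      bool→ℕ (x ≈ᵇ b) + mult xs x        ≡⟨ cong (λ u → bool→ℕ u + mult xs x) (≈ᵇ-respects x a≈b) ⟨
      bool→ℕ (x ≈ᵇ a) + mult xs x        ≡⟨ count-∷ (x ≈ᵇ_) a xs ⟨
      mult (a ∷ xs) x                    ≡⟨ same x ⟩
      mult (pre ++ b ∷ post) x           ≡⟨ count-middle (x ≈ᵇ_) pre post b ⟩
      bool→ℕ (x ≈ᵇ b) + mult (pre ++ post) x ∎)

  -- r pairs up the elements satisfying p, so any list containing each of them as often as its partner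
  -- has an even number of them.
  module Involution (p : A → Bool) (p-resp : Respects p) (r : A → A)
    (r-resp : ∀ {x y} → (x ≈ᵇ y) ≡ true → (r x ≈ᵇ r y) ≡ true)
    (r-involutive : ∀ x → (r (r x) ≈ᵇ x) ≡ true)
    (p∘r : ∀ x → p (r x) ≡ p x)
    (r-no-fixpoint : ∀ x → p x ≡ true → (x ≈ᵇ r x) ≡ false) where

    Balanced : List A → Set
    Balanced xs = ∀ x → p x ≡ true → mult xs x ≡ mult xs (r x)

    r-swap : ∀ {a b} → (r a ≈ᵇ b) ≡ true → (r b ≈ᵇ a) ≡ true
    r-swap {a} ra≈b = ≈-trans (r-resp (≈-sym ra≈b)) (r-involutive a)

    ≈-r-transpose : ∀ {a b} x → (r a ≈ᵇ b) ≡ true → (x ≈ᵇ a) ≡ (r x ≈ᵇ b)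
    ≈-r-transpose x ra≈b = ⇔→≡ (mk⇔
      (λ x≈a → ≈-trans (r-resp x≈a) ra≈b)
      (λ rx≈b → ≈-trans (≈-sym (r-involutive x)) (≈-trans (r-resp rx≈b) (r-swap ra≈b))))

    unrelated : ∀ {x a} → p x ≡ true → p a ≡ false → (x ≈ᵇ a) ≡ false
    unrelated {x} {a} px pa with x ≈ᵇ a in x≈a
    ... | true with () ← trans (sym px) (trans (p-resp x≈a) pa)
    ... | false = refl

    balanced-drop : ∀ {a xs} → p a ≡ false → Balanced (a ∷ xs) → Balanced xs
    balanced-drop {a} {xs} pa bal x px = +-cancelˡ-≡ 0 _ _ (begin
      mult xs x                             ≡⟨ cong (λ u → bool→ℕ u + mult xs x) (unrelated px pa) ⟨
      bool→ℕ (x ≈ᵇ a) + mult xs x           ≡⟨ count-∷ (x ≈ᵇ_) a xs ⟨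
      mult (a ∷ xs) x                       ≡⟨ bal x px ⟩
      mult (a ∷ xs) (r x)                   ≡⟨ count-∷ (r x ≈ᵇ_) a xs ⟩
      bool→ℕ (r x ≈ᵇ a) + mult xs (r x)     ≡⟨ cong (λ u → bool→ℕ u + mult xs (r x))
                                                     (unrelated (trans (p∘r x) px) pa) ⟩
      mult xs (r x)                         ∎)
      where open ≡-Reasoning

    mult-pair : ∀ a pre b post x →
      mult (a ∷ pre ++ b ∷ post) x ≡ (bool→ℕ (x ≈ᵇ a) + bool→ℕ (x ≈ᵇ b)) + mult (pre ++ post) x
    mult-pair a pre b post x
      rewrite count-∷ (x ≈ᵇ_) a (pre ++ b ∷ post) | count-middle (x ≈ᵇ_) pre post b =
      sym (+-assoc (bool→ℕ (x ≈ᵇ a)) _ _)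

    balanced-drop-pair : ∀ {a pre b post} → (r a ≈ᵇ b) ≡ true →
      Balanced (a ∷ pre ++ b ∷ post) → Balanced (pre ++ post)
    balanced-drop-pair {a} {pre} {b} {post} ra≈b bal x px =
      +-cancelˡ-≡ (bool→ℕ (x ≈ᵇ a) + bool→ℕ (x ≈ᵇ b)) _ _ (begin
        (bool→ℕ (x ≈ᵇ a) + bool→ℕ (x ≈ᵇ b)) + mult (pre ++ post) x       ≡⟨ mult-pair a pre b post x ⟨
        mult (a ∷ pre ++ b ∷ post) x                                     ≡⟨ bal x px ⟩
        mult (a ∷ pre ++ b ∷ post) (r x)                                 ≡⟨ mult-pair a pre b post (r x) ⟩
        (bool→ℕ (r x ≈ᵇ a) + bool→ℕ (r x ≈ᵇ b)) + mult (pre ++ post) (r x) ≡⟨ cong (_+ mult (pre ++ post) (r x)) swapped ⟩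
        (bool→ℕ (x ≈ᵇ a) + bool→ℕ (x ≈ᵇ b)) + mult (pre ++ post) (r x)  ∎)
      where
      open ≡-Reasoning
      swapped : bool→ℕ (r x ≈ᵇ a) + bool→ℕ (r x ≈ᵇ b) ≡ bool→ℕ (x ≈ᵇ a) + bool→ℕ (x ≈ᵇ b)
      swapped rewrite ≈-r-transpose x ra≈b | ≈-r-transpose x (r-swap ra≈b) = +-comm (bool→ℕ (r x ≈ᵇ a)) _

    partner-occurs : ∀ {a xs} → p a ≡ true → Balanced (a ∷ xs) → 0 < mult xs (r a)
    partner-occurs {a} {xs} pa bal = subst (0 <_) mult-ra (subst (0 <_) (bal a pa) (mult-head>0 a xs))
      where
      ra≉a : (r a ≈ᵇ a) ≡ false
      ra≉a with r a ≈ᵇ a in ra≈a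
      ... | true with () ← trans (sym (r-no-fixpoint a pa)) (≈-sym ra≈a)
      ... | false = refl
      mult-ra : mult (a ∷ xs) (r a) ≡ mult xs (r a)
      mult-ra = trans (count-∷ (r a ≈ᵇ_) a xs) (cong (λ u → bool→ℕ u + mult xs (r a)) ra≉a)

    balanced-count-even : ∀ xs → Balanced xs → parity (count p xs) ≡ false
    balanced-count-even xs = go (length xs) xs ≤-refl
      where
      go : ∀ fuel xs → length xs ≤ fuel → Balanced xs → parity (count p xs) ≡ false
      go _ [] _ _ = refl
      go (suc fuel) (a ∷ xs) (s≤s len) bal with p a in pa
      ... | false = go fuel xs len (balanced-drop {a} {xs} pa bal)
      ... | true with occurrence (r a) xs (partner-occurs {a} {xs} pa bal)
      ... | pre , b , post , refl , ra≈b
        rewrite count-middle p pre post b | trans (sym (p-resp ra≈b)) (trans (p∘r a) pa)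
              | not-involutive (parity (count p (pre ++ post))) =
        go fuel (pre ++ post) (≤-trans (n≤1+n _) (subst (_≤ fuel) (length-++-sucʳ pre b post) len))
           (balanced-drop-pair {a} {pre} {b} {post} ra≈b bal)

⌊⌋-⇔ : {A B : Set} → A ⇔ B → (a? : Dec A) (b? : Dec B) → ⌊ a? ⌋ ≡ ⌊ b? ⌋
⌊⌋-⇔ A⇔B a? b? = trans (isYes≗does a?) (trans (does-⇔ A⇔B a? b?) (sym (isYes≗does b?)))

==⇒≡ : {k : ℕ} {a b : Fin k} → (a == b) ≡ true → a ≡ b
==⇒≡ {a = a} {b} e with a ≟ b
... | yes a≡b = a≡b

==-refl : {k : ℕ} (a : Fin k) → (a == a) ≡ true
==-refl a = trans (isYes≗does (a ≟ a)) (dec-true (a ≟ a) refl)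

==-≢ : {k : ℕ} {a b : Fin k} → ¬ a ≡ b → (a == b) ≡ false
==-≢ {a = a} {b} a≢b = trans (isYes≗does (a ≟ b)) (dec-false (a ≟ b) a≢b)

==-sym : {k : ℕ} (a b : Fin k) → (a == b) ≡ (b == a)
==-sym a b = ⌊⌋-⇔ (mk⇔ sym sym) (a ≟ b) (b ≟ a)

==-suc : {k : ℕ} (a b : Fin k) → (fs a == fs b) ≡ (a == b)
==-suc a b = ⌊⌋-⇔ (mk⇔ fs-injective (cong fs)) (fs a ≟ fs b) (a ≟ b)

all-map : {A B : Set} (p : B → Bool) (f : A → B) (xs : List A) → all p (map f xs) ≡ all (p ∘ f) xs
all-map p f xs = cong and (sym (map-∘ xs))

all-allFin⁻ : {m : ℕ} (p : Fin m → Bool) → all p (allFin m) ≡ true → ∀ i → p i ≡ true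
all-allFin⁻ {suc m} p e fz = ∧-conicalˡ _ _ e
all-allFin⁻ {suc m} p e (fs i) =
  all-allFin⁻ (p ∘ fs) (trans (sym (all-map p fs (allFin m))) (∧-conicalʳ _ _ e)) i

all-allFin⁺ : {m : ℕ} (p : Fin m → Bool) → (∀ i → p i ≡ true) → all p (allFin m) ≡ true
all-allFin⁺ {zero} p h = refl
all-allFin⁺ {suc m} p h rewrite h fz = trans (all-map p fs (allFin m)) (all-allFin⁺ (p ∘ fs) (h ∘ fs))

count-allFin : {m : ℕ} (a : Fin m) → count (a ==_) (allFin m) ≡ 1
count-allFin {suc m} fz = cong suc (trans (count-map (fz ==_) fs (allFin m)) (count-none (λ _ → refl) (allFin m)))
count-allFin {suc m} (fs a) =
  trans (count-map (fs a ==_) fs (allFin m)) (trans (count-cong (==-suc a) (allFin m)) (count-allFin a))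

_≗ᵇ_ : {m k : ℕ} → (Fin m → Fin k) → (Fin m → Fin k) → Bool
_≗ᵇ_ {m} f g = all (λ i → f i == g i) (allFin m)

module _ {m k : ℕ} where

  ≗ᵇ⇒≗ : {f g : Fin m → Fin k} → (f ≗ᵇ g) ≡ true → ∀ i → f i ≡ g i
  ≗ᵇ⇒≗ e i = ==⇒≡ (all-allFin⁻ _ e i)

  ≗⇒≗ᵇ : {f g : Fin m → Fin k} → (∀ i → f i ≡ g i) → (f ≗ᵇ g) ≡ true
  ≗⇒≗ᵇ {f} f≗g = all-allFin⁺ _ (λ i → subst (λ t → (f i == t) ≡ true) (f≗g i) (==-refl (f i)))

  ≗ᵇ-refl : (f : Fin m → Fin k) → (f ≗ᵇ f) ≡ true
  ≗ᵇ-refl f = ≗⇒≗ᵇ (λ _ → refl)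

  ≗ᵇ-sym : {f g : Fin m → Fin k} → (f ≗ᵇ g) ≡ true → (g ≗ᵇ f) ≡ true
  ≗ᵇ-sym e = ≗⇒≗ᵇ (λ i → sym (≗ᵇ⇒≗ e i))

  ≗ᵇ-trans : {f g h : Fin m → Fin k} → (f ≗ᵇ g) ≡ true → (g ≗ᵇ h) ≡ true → (f ≗ᵇ h) ≡ true
  ≗ᵇ-trans e e′ = ≗⇒≗ᵇ (λ i → trans (≗ᵇ⇒≗ e i) (≗ᵇ⇒≗ e′ i))

  Extensional : ((Fin m → Fin k) → Bool) → Set
  Extensional P = ∀ {f g} → (∀ i → f i ≡ g i) → P f ≡ P g

≗ᵇ-∷ : {m k : ℕ} (f : Fin (suc m) → Fin k) (a : Fin k) (g : Fin m → Fin k) →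
  (f ≗ᵇ (a ∷ᶠ g)) ≡ ((f fz == a) ∧ ((f ∘ fs) ≗ᵇ g))
≗ᵇ-∷ {m} f a g = cong ((f fz == a) ∧_) (all-map (λ i → f i == (a ∷ᶠ g) i) fs (allFin m))

count-allFuns : (m k : ℕ) (f : Fin m → Fin k) → count (f ≗ᵇ_) (allFuns m k) ≡ 1
count-allFuns zero k f = refl
count-allFuns (suc m) k f = begin
  count (f ≗ᵇ_) (allFuns (suc m) k)
    ≡⟨ count-concatMap (f ≗ᵇ_) _ (allFin k) ⟩
  sum (map (λ a → count (f ≗ᵇ_) (map (a ∷ᶠ_) (allFuns m k))) (allFin k))
    ≡⟨ sum-map-cong first-value (allFin k) ⟩
  sum (map (bool→ℕ ∘ (f fz ==_)) (allFin k))
    ≡⟨ sum-map-bool→ℕ (f fz ==_) (allFin k) ⟩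
  count (f fz ==_) (allFin k)
    ≡⟨ count-allFin (f fz) ⟩
  1 ∎
  where
  open ≡-Reasoning
  first-value : ∀ a → count (f ≗ᵇ_) (map (a ∷ᶠ_) (allFuns m k)) ≡ bool→ℕ (f fz == a)
  first-value a = begin
    count (f ≗ᵇ_) (map (a ∷ᶠ_) (allFuns m k))                  ≡⟨ count-map (f ≗ᵇ_) (a ∷ᶠ_) (allFuns m k) ⟩
    count (λ g → f ≗ᵇ (a ∷ᶠ g)) (allFuns m k)                 ≡⟨ count-cong (≗ᵇ-∷ f a) (allFuns m k) ⟩
    count (λ g → (f fz == a) ∧ ((f ∘ fs) ≗ᵇ g)) (allFuns m k) ≡⟨ count-const-∧ (f fz == a) ((f ∘ fs) ≗ᵇ_) (allFuns m k) ⟩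
    bool→ℕ (f fz == a) * count ((f ∘ fs) ≗ᵇ_) (allFuns m k)   ≡⟨ cong (bool→ℕ (f fz == a) *_) (count-allFuns m k (f ∘ fs)) ⟩
    bool→ℕ (f fz == a) * 1                                    ≡⟨ *-identityʳ _ ⟩
    bool→ℕ (f fz == a)                                        ∎

module FunctionMultiplicity (m k : ℕ) =
  Multiplicity (_≗ᵇ_ {m} {k}) ≗ᵇ-refl (λ {f} {g} → ≗ᵇ-sym {f = f} {g})
               (λ {f} {g} {h} → ≗ᵇ-trans {f = f} {g} {h})

module _ {m k : ℕ} where
  open FunctionMultiplicity m k

  count-allFuns-∘ : {P : (Fin m → Fin k) → Bool} → Extensional P →
    (π π⁻¹ : Fin m → Fin m) → (∀ i → π (π⁻¹ i) ≡ i) → (∀ i → π⁻¹ (π i) ≡ i) →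
    count P (allFuns m k) ≡ count (λ f → P (f ∘ π)) (allFuns m k)
  count-allFuns-∘ {P} ext π π⁻¹ ππ⁻¹ π⁻¹π =
    trans (count-cong-mult (λ e → ext (≗ᵇ⇒≗ e)) F (map (_∘ π) F) same) (count-map P (_∘ π) F)
    where
    F : List (Fin m → Fin k)
    F = allFuns m k
    precompose : ∀ f g → (f ≗ᵇ (g ∘ π)) ≡ ((f ∘ π⁻¹) ≗ᵇ g)
    precompose f g = ⇔→≡ (mk⇔
      (λ e → ≗⇒≗ᵇ (λ i → trans (≗ᵇ⇒≗ e (π⁻¹ i)) (cong g (ππ⁻¹ i))))
      (λ e → ≗⇒≗ᵇ (λ i → trans (cong f (sym (π⁻¹π i))) (≗ᵇ⇒≗ e (π i)))))
    same : ∀ f → mult F f ≡ mult (map (_∘ π) F) f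
    same f = begin
      mult F f                       ≡⟨ count-allFuns m k f ⟩
      1                               ≡⟨ count-allFuns m k (f ∘ π⁻¹) ⟨
      count ((f ∘ π⁻¹) ≗ᵇ_) F        ≡⟨ count-cong (precompose f) F ⟨
      count (λ g → f ≗ᵇ (g ∘ π)) F   ≡⟨ count-map (f ≗ᵇ_) (_∘ π) F ⟨
      mult (map (_∘ π) F) f          ∎
      where open ≡-Reasoning

  count-allFuns-even : {P : (Fin m → Fin k) → Bool} → Extensional P →
    (π : Fin m → Fin m) → (∀ i → π (π i) ≡ i) → (∀ f → P (f ∘ π) ≡ P f) →
    (∀ f → P f ≡ true → ¬ (∀ i → f i ≡ f (π i))) →
    parity (count P (allFuns m k)) ≡ false
  count-allFuns-even {P} ext π ππ P∘π no-fixpoint =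
    balanced-count-even (allFuns m k) (λ f _ → trans (count-allFuns m k f) (sym (count-allFuns m k (f ∘ π))))
    where
    open Involution P (λ e → ext (≗ᵇ⇒≗ e)) (_∘ π)
      (λ e → ≗⇒≗ᵇ (λ i → ≗ᵇ⇒≗ e (π i))) (λ f → ≗⇒≗ᵇ (λ i → cong f (ππ i))) P∘π
      (λ f Pf → ¬-not (λ e → no-fixpoint f Pf (≗ᵇ⇒≗ e)))

count-allFuns-at : {m k : ℕ} {P : (Fin m → Fin k) → Bool} → Extensional P → (g : Fin m → Fin k) →
  count (λ σ → P σ ∧ (g ≗ᵇ σ)) (allFuns m k) ≡ bool→ℕ (P g)
count-allFuns-at {m} {k} {P} ext g = begin
  count (λ σ → P σ ∧ (g ≗ᵇ σ)) (allFuns m k)   ≡⟨ count-cong at-g (allFuns m k) ⟩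
  count (λ σ → P g ∧ (g ≗ᵇ σ)) (allFuns m k)   ≡⟨ count-const-∧ (P g) (g ≗ᵇ_) (allFuns m k) ⟩
  bool→ℕ (P g) * count (g ≗ᵇ_) (allFuns m k)   ≡⟨ cong (bool→ℕ (P g) *_) (count-allFuns m k g) ⟩
  bool→ℕ (P g) * 1                             ≡⟨ *-identityʳ _ ⟩
  bool→ℕ (P g)                                 ∎
  where
  open ≡-Reasoning
  at-g : ∀ σ → (P σ ∧ (g ≗ᵇ σ)) ≡ (P g ∧ (g ≗ᵇ σ))
  at-g σ with g ≗ᵇ σ in g≗σ
  ... | true = cong (_∧ true) (sym (ext (≗ᵇ⇒≗ g≗σ)))
  ... | false = trans (∧-zeroʳ (P σ)) (sym (∧-zeroʳ (P g)))

module _ {k : ℕ} where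

  any-==-split : (x : Fin k) (xs : List (Fin k)) → any (x ==_) xs ≡ true →
    ∃[ B ] ∃[ C ] xs ≡ B ++ x ∷ C
  any-==-split x (y ∷ ys) e with x == y in x=y
  ... | true = [] , ys , cong (_∷ ys) (sym (==⇒≡ x=y))
  ... | false with any-==-split x ys e
  ... | B , C , refl = y ∷ B , C , refl

  ¬distinct⇒repeat : (xs : List (Fin k)) → distinct xs ≡ false →
    ∃[ A ] ∃[ x ] ∃[ B ] ∃[ C ] xs ≡ A ++ x ∷ B ++ x ∷ C
  ¬distinct⇒repeat (x ∷ xs) e with any (x ==_) xs in x∈xs
  ... | true with any-==-split x xs x∈xs
  ... | B , C , refl = [] , x , B , C , refl
  ¬distinct⇒repeat (x ∷ xs) e | false with ¬distinct⇒repeat xs e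
  ... | A , y , B , C , refl = x ∷ A , y , B , C , refl

module ClosedWalks (H : Graph) where

  ClosedWalk : List (V H) → Bool
  ClosedWalk xs = pathAdj H (xs ++ take 1 xs)

  pathAdj-++ : (P Q : List (V H)) (y : V H) →
    pathAdj H (P ++ y ∷ Q) ≡ (pathAdj H (P ++ [ y ]) ∧ pathAdj H (y ∷ Q))
  pathAdj-++ [] Q y = refl
  pathAdj-++ (p ∷ []) Q y = cong (_∧ pathAdj H (y ∷ Q)) (sym (∧-identityʳ (adj H p y)))
  pathAdj-++ (p ∷ p′ ∷ P) Q y =
    trans (cong (adj H p p′ ∧_) (pathAdj-++ (p′ ∷ P) Q y)) (sym (∧-assoc (adj H p p′) _ _))

  closedWalk-rotate : (A R : List (V H)) (x : V H) →
    ClosedWalk (A ++ x ∷ R) ≡ true → ClosedWalk (x ∷ R ++ A) ≡ true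
  closedWalk-rotate [] R x e = subst (λ t → pathAdj H (x ∷ t ++ [ x ]) ≡ true) (sym (++-identityʳ R)) e
  closedWalk-rotate (a ∷ A) R x e =
    subst (λ t → pathAdj H (x ∷ t) ≡ true) (sym (++-assoc R (a ∷ A) [ x ]))
      (trans (pathAdj-++ (x ∷ R) (A ++ [ x ]) a) (cong₂ _∧_ (∧-conicalʳ (pathAdj H ((a ∷ A) ++ [ x ])) _ halves) (∧-conicalˡ _ _ halves)))
    where
    halves : (pathAdj H ((a ∷ A) ++ [ x ]) ∧ pathAdj H (x ∷ R ++ [ a ])) ≡ true
    halves = trans (sym (pathAdj-++ (a ∷ A) (R ++ [ a ]) x))
                   (subst (λ t → pathAdj H (a ∷ t) ≡ true) (++-assoc A (x ∷ R) [ a ]) e)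

  closedWalk-split : (x : V H) (B C : List (V H)) → ClosedWalk (x ∷ B ++ x ∷ C) ≡ true →
    (ClosedWalk (x ∷ B) ≡ true) × (ClosedWalk (x ∷ C) ≡ true)
  closedWalk-split x B C e = ∧-conicalˡ _ _ halves , ∧-conicalʳ _ _ halves
    where
    halves : (pathAdj H ((x ∷ B) ++ [ x ]) ∧ pathAdj H (x ∷ C ++ [ x ])) ≡ true
    halves = trans (sym (pathAdj-++ (x ∷ B) (C ++ [ x ]) x))
                   (subst (λ t → pathAdj H (x ∷ t) ≡ true) (++-assoc B (x ∷ C) [ x ]) e)

  OddClosedWalk : List (V H) → Set
  OddClosedWalk xs = (ClosedWalk xs ≡ true) × (parity (length xs) ≡ true)

  -- Cut at a repeated vertex: the two closed walks have lengths summing to the original odd length.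
  shorter-odd-closed-walk : (xs : List (V H)) → OddClosedWalk xs → distinct xs ≡ false →
    ∃[ ys ] OddClosedWalk ys × (length ys < length xs)
  shorter-odd-closed-walk xs (closed , odd) repeated with ¬distinct⇒repeat xs repeated
  ... | A , x , B , C , refl = pick
    where
    pieces : (ClosedWalk (x ∷ B) ≡ true) × (ClosedWalk (x ∷ C ++ A) ≡ true)
    pieces = closedWalk-split x B (C ++ A)
      (subst (λ t → ClosedWalk (x ∷ t) ≡ true) (++-assoc B (x ∷ C) A) (closedWalk-rotate A (B ++ x ∷ C) x closed))
    lengths : length (A ++ x ∷ B ++ x ∷ C) ≡ length (x ∷ B) + length (x ∷ C ++ A)
    lengths = begin
      length (A ++ x ∷ B ++ x ∷ C)            ≡⟨ length-++ A ⟩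
      length A + length (x ∷ B ++ x ∷ C)      ≡⟨ +-comm (length A) _ ⟩
      length (x ∷ B ++ x ∷ C) + length A      ≡⟨ cong (λ t → suc t + length A) (length-++ B) ⟩
      suc (length B + length (x ∷ C)) + length A ≡⟨ cong suc (+-assoc (length B) _ (length A)) ⟩
      suc (length B + suc (length C + length A)) ≡⟨ cong (λ t → suc (length B + suc t)) (length-++ C) ⟨
      length (x ∷ B) + length (x ∷ C ++ A)    ∎
      where open ≡-Reasoning
    odd-sum : (parity (length (x ∷ B)) xor parity (length (x ∷ C ++ A))) ≡ true
    odd-sum = trans (sym (parity-+ (length (x ∷ B)) _)) (trans (cong parity (sym lengths)) odd)
    pick : ∃[ ys ] OddClosedWalk ys × (length ys < length (A ++ x ∷ B ++ x ∷ C))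
    pick with parity (length (x ∷ B)) in pB
    ... | true = x ∷ B , (proj₁ pieces , pB) ,
                 subst (length (x ∷ B) <_) (sym lengths) (m<m+n _ (s≤s z≤n))
    ... | false = x ∷ C ++ A , (proj₂ pieces , subst (λ b → (b xor _) ≡ true) pB odd-sum) ,
                 subst (length (x ∷ C ++ A) <_) (sym lengths) (m<n+m _ (s≤s z≤n))

  cycleSeq⇒HasCycle : (xs : List (V H)) → T (isCycleSeq H xs) → HasCycle H (length xs)
  cycleSeq⇒HasCycle xs t = lookup xs , subst (λ ys → T (isCycleSeq H ys)) (sym (tabulate-lookup xs)) t

  odd-closed-walk⇒odd-cycle : (xs : List (V H)) → OddClosedWalk xs →
    ∃[ k ] OddN k × (k ≤ length xs) × HasCycle H k
  odd-closed-walk⇒odd-cycle xs = go (length xs) xs ≤-refl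
    where
    go : ∀ fuel xs → length xs ≤ fuel → OddClosedWalk xs → ∃[ k ] OddN k × (k ≤ length xs) × HasCycle H k
    go fuel xs len ocw with distinct xs in d
    go fuel [] _ (_ , ()) | true
    go fuel (x ∷ []) _ (closed , _) | true with () ← trans (sym (∧-conicalˡ _ _ closed)) (irrefl H x)
    go fuel (x ∷ y ∷ []) _ (_ , ()) | true
    go fuel xs@(_ ∷ _ ∷ _ ∷ _) _ (closed , odd) | true =
      length xs , parity⇒OddN _ odd , ≤-refl , cycleSeq⇒HasCycle xs (≡true⇒T (cong₂ _∧_ d closed))
    go fuel xs len ocw | false with shorter-odd-closed-walk xs ocw d
    go zero xs len ocw | false | ys , _ , shorter = ⊥-elim (<⇒≱ (≤-trans shorter len) z≤n)
    go (suc fuel) xs len ocw | false | ys , ocw′ , shorter with go fuel ys (≤-pred (≤-trans shorter len)) ocw′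
    ... | k , odd-k , k≤ , cycle = k , odd-k , ≤-trans k≤ (<⇒≤ shorter) , cycle

  closed-walk-of-odd-girth-is-distinct : {ℓ : ℕ} → (∀ k → OddN k → k < ℓ → ¬ HasCycle H k) →
    (xs : List (V H)) → length xs ≡ ℓ → OddClosedWalk xs → distinct xs ≡ true
  closed-walk-of-odd-girth-is-distinct no-shorter xs refl ocw with distinct xs in d
  ... | true = refl
  ... | false with shorter-odd-closed-walk xs ocw d
  ... | ys , ocw′ , shorter with odd-closed-walk⇒odd-cycle ys ocw′
  ... | k , odd-k , k≤ , cycle = ⊥-elim (no-shorter k odd-k (≤-<-trans k≤ shorter) cycle)

IsGraphHom : (G H : Graph) → (V G → V H) → Set
IsGraphHom G H σ = ∀ i j → adj G i j ≡ true → adj H (σ i) (σ j) ≡ true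

-- The first conjunct of isHom, so that isHom J σ ≡ edgeCheck (G J) H σ ∧ … holds by definition.
edgeCheck : (G H : Graph) → (V G → V H) → Bool
edgeCheck G H σ = all (λ i → all (λ j → not (adj G i j) ∨ adj H (σ i) (σ j)) (allFin (n G))) (allFin (n G))

module _ (G H : Graph) where

  edgeCheck⇒IsGraphHom : ∀ {σ} → edgeCheck G H σ ≡ true → IsGraphHom G H σ
  edgeCheck⇒IsGraphHom {σ} e i j i~j with adj G i j | all-allFin⁻ _ (all-allFin⁻ _ e i) j
  edgeCheck⇒IsGraphHom {σ} e i j refl | true | preserved = preserved

  IsGraphHom⇒edgeCheck : ∀ {σ} → IsGraphHom G H σ → edgeCheck G H σ ≡ true
  IsGraphHom⇒edgeCheck {σ} hom = all-allFin⁺ _ (λ i → all-allFin⁺ _ (preserved i))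
    where
    preserved : ∀ i j → (not (adj G i j) ∨ adj H (σ i) (σ j)) ≡ true
    preserved i j with adj G i j in i~j
    ... | true = hom i j i~j
    ... | false = refl

  edgeCheck-extensional : ∀ {σ τ} → (∀ i → σ i ≡ τ i) → edgeCheck G H σ ≡ edgeCheck G H τ
  edgeCheck-extensional σ≗τ = ⇔→≡ (mk⇔ (transport σ≗τ) (transport (sym ∘ σ≗τ)))
    where
    transport : ∀ {σ τ} → (∀ i → σ i ≡ τ i) → edgeCheck G H σ ≡ true → edgeCheck G H τ ≡ true
    transport σ≗τ e = IsGraphHom⇒edgeCheck λ i j i~j →
      subst₂ (λ x y → adj H x y ≡ true) (σ≗τ i) (σ≗τ j) (edgeCheck⇒IsGraphHom e i j i~j)

  edgeCheck-∘-involution : (π : V G → V G) → IsGraphHom G G π → (∀ i → π (π i) ≡ i) →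
    ∀ σ → edgeCheck G H (σ ∘ π) ≡ edgeCheck G H σ
  edgeCheck-∘-involution π π-hom ππ σ = ⇔→≡ (mk⇔
    (λ e → trans (edgeCheck-extensional (λ i → sym (cong σ (ππ i)))) (compose e))
    compose)
    where
    compose : ∀ {τ} → edgeCheck G H τ ≡ true → edgeCheck G H (τ ∘ π) ≡ true
    compose e = IsGraphHom⇒edgeCheck λ i j i~j → edgeCheck⇒IsGraphHom e (π i) (π j) (π-hom i j i~j)

-- Σ_a |Hom((J,y),(H,a))| = |Hom(J,H)|, and a sum has the parity of its number of odd terms.
omegaSize-parity : {H : Graph} (J : PLGraph H) (y : V (G J)) →
  parity (omegaSize J y) ≡ parity (count (isHom J) (allFuns (n (G J)) (n H)))
omegaSize-parity {H} J y = begin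
  parity (count (λ a → oddB (hom1 J y a)) (allFin (n H)))          ≡⟨ cong parity (count-cong (oddB≡parity ∘ hom1 J y) (allFin (n H))) ⟩
  parity (count (parity ∘ hom1 J y) (allFin (n H)))                ≡⟨ parity-sum (hom1 J y) (allFin (n H)) ⟨
  parity (sum (map (hom1 J y) (allFin (n H))))                     ≡⟨ cong parity (sum-count-by-key (isHom J) (λ σ a → σ y == a)
                                                                        (allFin (n H)) (λ σ → count-allFin (σ y)) (allFuns (n (G J)) (n H))) ⟩
  parity (count (isHom J) (allFuns (n (G J)) (n H)))               ∎
  where open ≡-Reasoning

ConsecutivelyAdjacent : (G : Graph) {m : ℕ} → (Fin (suc m) → V G) → Set
ConsecutivelyAdjacent G {m} w = (i : Fin m) → adj G (w (inject₁ i)) (w (fs i)) ≡ true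

pathAdj-toList : (G : Graph) (m : ℕ) (w : Fin (suc m) → V G) →
  ConsecutivelyAdjacent G w → pathAdj G (toList w) ≡ true
pathAdj-toList G zero w _ = refl
pathAdj-toList G (suc m) w consecutive =
  cong₂ _∧_ (consecutive fz) (pathAdj-toList G m (w ∘ fs) (consecutive ∘ fs))

pathAdj-toList-∷ʳ⁺ : (G : Graph) (m : ℕ) (w : Fin (suc m) → V G) (z : V G) →
  ConsecutivelyAdjacent G w → adj G (w (fromℕ m)) z ≡ true → pathAdj G (toList w ++ [ z ]) ≡ true
pathAdj-toList-∷ʳ⁺ G zero w z _ last = cong (_∧ true) last
pathAdj-toList-∷ʳ⁺ G (suc m) w z consecutive last =
  cong₂ _∧_ (consecutive fz) (pathAdj-toList-∷ʳ⁺ G m (w ∘ fs) z (consecutive ∘ fs) last)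

pathAdj-toList-∷ʳ⁻ : (G : Graph) (m : ℕ) (w : Fin (suc m) → V G) (z : V G) →
  pathAdj G (toList w ++ [ z ]) ≡ true → ConsecutivelyAdjacent G w × (adj G (w (fromℕ m)) z ≡ true)
pathAdj-toList-∷ʳ⁻ G zero w z e = (λ ()) , ∧-conicalˡ _ _ e
pathAdj-toList-∷ʳ⁻ G (suc m) w z e with pathAdj-toList-∷ʳ⁻ G m (w ∘ fs) z (∧-conicalʳ (adj G (w fz) (w (fs fz))) _ e)
... | consecutive , last = (λ { fz → ∧-conicalˡ _ _ e ; (fs i) → consecutive i }) , last

module CycleGraph (k : ℕ) where

  ℓ : ℕ
  ℓ = suc (suc (suc k))

  top : ℕ
  top = suc (suc k)

  Step : ℕ → ℕ → Set
  Step i j = (suc i ≡ j) ⊎ ((i ≡ top) × (j ≡ 0))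

  step? : ∀ i j → Dec (Step i j)
  step? i j = (suc i ℕ.≟ j) ⊎-dec ((i ℕ.≟ top) ×-dec (j ℕ.≟ 0))

  ¬Step-refl : ∀ i → ¬ Step i i
  ¬Step-refl i (inj₁ 1+i≡i) = 1+n≢n 1+i≡i
  ¬Step-refl i (inj₂ (refl , ()))

  Adjacent : Fin ℓ → Fin ℓ → Set
  Adjacent i j = Step (toℕ i) (toℕ j) ⊎ Step (toℕ j) (toℕ i)

  adjacent? : ∀ i j → Dec (Adjacent i j)
  adjacent? i j = step? (toℕ i) (toℕ j) ⊎-dec step? (toℕ j) (toℕ i)

  cycle : Graph
  cycle = record
    { n = ℓ
    ; adj = λ i j → does (adjacent? i j)
    ; sym = λ i j → does-⇔ (mk⇔ Data.Sum.swap Data.Sum.swap) (adjacent? i j) (adjacent? j i)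
    ; irrefl = λ i → dec-false (adjacent? i i) λ { (inj₁ s) → ¬Step-refl (toℕ i) s ; (inj₂ s) → ¬Step-refl (toℕ i) s }
    }

  adj⇒Adjacent : ∀ {i j} → adj cycle i j ≡ true → Adjacent i j
  adj⇒Adjacent {i} {j} = does⇒ (adjacent? i j)

  Adjacent⇒adj : ∀ {i j} → Adjacent i j → adj cycle i j ≡ true
  Adjacent⇒adj {i} {j} = dec-true (adjacent? i j)

  -- r is the reflection of j in c: j + r ≡ c (mod ℓ), with both sides below 2ℓ.
  Reflected : ℕ → ℕ → ℕ → Set
  Reflected c j r = ((j ≤ c) × (j + r ≡ c)) ⊎ ((c < j) × (j + r ≡ ℓ + c))

  reflected-exists : ∀ c j → c < ℓ → j < ℓ → ∃[ r ] (r < ℓ) × Reflected c j r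
  reflected-exists c j c<ℓ j<ℓ with j ≤? c
  ... | yes j≤c = c ∸ j , ≤-<-trans (m∸n≤m c j) c<ℓ , inj₁ (j≤c , m+[n∸m]≡n j≤c)
  ... | no j≰c = ℓ + c ∸ j , below , inj₂ (≰⇒> j≰c , m+[n∸m]≡n j≤ℓ+c)
    where
    j≤ℓ+c : j ≤ ℓ + c
    j≤ℓ+c = ≤-trans (<⇒≤ j<ℓ) (m≤m+n ℓ c)
    below : ℓ + c ∸ j < ℓ
    below = +-cancelˡ-< j _ _ (subst (_< j + ℓ) (sym (m+[n∸m]≡n j≤ℓ+c))
                                (subst (_< j + ℓ) (+-comm c ℓ) (+-monoˡ-< ℓ (≰⇒> j≰c))))

  reflected-sym : ∀ c j r → j < ℓ → Reflected c j r → Reflected c r j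
  reflected-sym c j r j<ℓ (inj₁ (_ , j+r≡c)) = inj₁ (subst (r ≤_) j+r≡c (m≤n+m r j) , trans (+-comm r j) j+r≡c)
  reflected-sym c j r j<ℓ (inj₂ (_ , j+r≡ℓ+c)) =
    inj₂ (+-cancelˡ-< j c r (subst (j + c <_) (sym j+r≡ℓ+c) (+-monoˡ-< c j<ℓ)) , trans (+-comm r j) j+r≡ℓ+c)

  reflected-unique : ∀ {c j r r′} → Reflected c j r → Reflected c j r′ → r ≡ r′
  reflected-unique {j = j} (inj₁ (_ , e)) (inj₁ (_ , e′)) = +-cancelˡ-≡ j _ _ (trans e (sym e′))
  reflected-unique {j = j} (inj₂ (_ , e)) (inj₂ (_ , e′)) = +-cancelˡ-≡ j _ _ (trans e (sym e′))
  reflected-unique (inj₁ (j≤c , _)) (inj₂ (c<j , _)) = ⊥-elim (<⇒≱ c<j j≤c)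
  reflected-unique (inj₂ (c<j , _)) (inj₁ (j≤c , _)) = ⊥-elim (<⇒≱ c<j j≤c)

  reflected-step : ∀ {c a b ra rb} → c < ℓ → Step a b → Reflected c a ra → Reflected c b rb → Step rb ra
  reflected-step {a = a} _ (inj₁ refl) (inj₁ (_ , ea)) (inj₁ (_ , eb)) =
    inj₁ (+-cancelˡ-≡ a _ _ (trans (+-suc a _) (trans eb (sym ea))))
  reflected-step {a = a} _ (inj₁ refl) (inj₂ (_ , ea)) (inj₂ (_ , eb)) =
    inj₁ (+-cancelˡ-≡ a _ _ (trans (+-suc a _) (trans eb (sym ea))))
  reflected-step _ (inj₁ refl) (inj₂ (c<a , _)) (inj₁ (1+a≤c , _)) = ⊥-elim (<⇒≱ c<a (≤-trans (n≤1+n _) 1+a≤c))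
  reflected-step {c} {a} {ra = ra} {rb} _ (inj₁ refl) (inj₁ (a≤c , ea)) (inj₂ (c<1+a , eb)) = inj₂ (rb≡top , ra≡0)
    where
    a≡c : a ≡ c
    a≡c = ≤-antisym a≤c (≤-pred c<1+a)
    ra≡0 : ra ≡ 0
    ra≡0 = +-cancelˡ-≡ a ra 0 (trans ea (trans (sym a≡c) (sym (+-identityʳ a))))
    rb≡top : rb ≡ top
    rb≡top = +-cancelˡ-≡ (suc c) rb top (trans (cong (λ t → suc t + rb) (sym a≡c)) (trans eb (cong suc (+-comm top c))))
  reflected-step _ (inj₂ (refl , refl)) _ (inj₂ (() , _))
  reflected-step {c} {ra = ra} c<ℓ (inj₂ (refl , refl)) (inj₁ (top≤c , ea)) (inj₁ (_ , eb)) = inj₂ (trans eb (sym top≡c) , ra≡0)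
    where
    top≡c : top ≡ c
    top≡c = ≤-antisym top≤c (≤-pred c<ℓ)
    ra≡0 : ra ≡ 0
    ra≡0 = +-cancelˡ-≡ top ra 0 (trans ea (trans (sym top≡c) (sym (+-identityʳ top))))
  reflected-step _ (inj₂ (refl , refl)) (inj₂ (_ , ea)) (inj₁ (_ , eb)) =
    inj₁ (+-cancelˡ-≡ top _ _ (trans (+-suc top _) (trans (cong (λ t → suc (top + t)) eb) (sym ea))))

  module Reflection (c : ℕ) (c<ℓ : c < ℓ) where

    reflect : Fin ℓ → Fin ℓ
    reflect j = fromℕ< (proj₁ (proj₂ (reflected-exists c (toℕ j) c<ℓ (toℕ<n j))))

    reflect-reflected : ∀ j → Reflected c (toℕ j) (toℕ (reflect j))
    reflect-reflected j = subst (Reflected c (toℕ j)) (sym (toℕ-fromℕ< _))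
                            (proj₂ (proj₂ (reflected-exists c (toℕ j) c<ℓ (toℕ<n j))))

    toℕ-reflect : ∀ j {r} → Reflected c (toℕ j) r → toℕ (reflect j) ≡ r
    toℕ-reflect j = reflected-unique (reflect-reflected j)

    reflect-involutive : ∀ j → reflect (reflect j) ≡ j
    reflect-involutive j = toℕ-injective (toℕ-reflect (reflect j)
      (reflected-sym c (toℕ j) (toℕ (reflect j)) (toℕ<n j) (reflect-reflected j)))

    reflect-adjacent : ∀ {i j} → Adjacent i j → Adjacent (reflect i) (reflect j)
    reflect-adjacent {i} {j} (inj₁ s) = inj₂ (reflected-step c<ℓ s (reflect-reflected i) (reflect-reflected j))
    reflect-adjacent {i} {j} (inj₂ s) = inj₁ (reflected-step c<ℓ s (reflect-reflected j) (reflect-reflected i))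

    reflect-isGraphHom : IsGraphHom cycle cycle reflect
    reflect-isGraphHom i j i~j = Adjacent⇒adj (reflect-adjacent (adj⇒Adjacent {i} {j} i~j))

  module Swap₀₁ = Reflection 1 (s≤s (s≤s z≤n))
  module Fix₀ = Reflection 0 (s≤s z≤n)

  -- For ℓ = 2t + 3 the reflection fixing 0 swaps the adjacent vertices t + 1 and t + 2.
  Fix₀-flips-edge : parity ℓ ≡ true → ∃[ m ] Adjacent m (Fix₀.reflect m)
  Fix₀-flips-edge odd with parity≡false⇒double k (not-injective {y = false} (trans (sym (parity-suc-suc (suc k))) odd))
  ... | t , k≡t+t = m , inj₁ (inj₁ (trans (cong suc (toℕ-fromℕ< m<ℓ)) (sym (Fix₀.toℕ-reflect m reflected))))
    where
    m<ℓ : suc t < ℓ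
    m<ℓ = s≤s (s≤s (≤-trans (subst (t ≤_) (sym k≡t+t) (m≤m+n t t)) (n≤1+n k)))
    m : Fin ℓ
    m = fromℕ< m<ℓ
    m+ρm≡ℓ : suc t + suc (suc t) ≡ ℓ + 0
    m+ρm≡ℓ = begin
      suc t + suc (suc t)       ≡⟨ cong suc (trans (+-suc t (suc t)) (cong suc (+-suc t t))) ⟩
      suc (suc (suc (t + t)))   ≡⟨ cong (suc ∘ suc ∘ suc) k≡t+t ⟨
      ℓ                         ≡⟨ +-identityʳ ℓ ⟨
      ℓ + 0                     ∎
      where open ≡-Reasoning
    reflected : Reflected 0 (toℕ m) (suc (suc t))
    reflected = inj₂ (subst (0 <_) (sym (toℕ-fromℕ< m<ℓ)) (s≤s z≤n) ,
                      subst (λ x → x + suc (suc t) ≡ ℓ + 0) (sym (toℕ-fromℕ< m<ℓ)) m+ρm≡ℓ)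

  next : Fin ℓ → Fin ℓ
  next j with suc (toℕ j) <? ℓ
  ... | yes below = fromℕ< below
  ... | no _ = fz

  step-next : ∀ j → Step (toℕ j) (toℕ (next j))
  step-next j with suc (toℕ j) <? ℓ
  ... | yes below = inj₁ (sym (toℕ-fromℕ< below))
  ... | no ¬below = inj₂ (≤-antisym (≤-pred (toℕ<n j)) (≮⇒≥ (¬below ∘ s≤s)) , refl)

  toℕ-next : ∀ j → suc (toℕ j) < ℓ → toℕ (next j) ≡ suc (toℕ j)
  toℕ-next j below with step-next j
  ... | inj₁ e = sym e
  ... | inj₂ (j≡top , _) = ⊥-elim (<-irrefl j≡top (≤-pred below))

  next-top : next (fromℕ top) ≡ fz
  next-top with step-next (fromℕ top)
  ... | inj₁ e = ⊥-elim (<-irrefl (trans (sym e) (cong suc (toℕ-fromℕ top))) (toℕ<n (next (fromℕ top))))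
  ... | inj₂ (_ , e) = toℕ-injective e

  advance : ℕ → Fin ℓ → Fin ℓ
  advance zero j = j
  advance (suc m) j = advance m (next j)

  advance-suc : ∀ m j → advance (suc m) j ≡ next (advance m j)
  advance-suc zero j = refl
  advance-suc (suc m) j = advance-suc m (next j)

  advance-+ : ∀ a b j → advance (a + b) j ≡ advance b (advance a j)
  advance-+ zero b j = refl
  advance-+ (suc a) b j = advance-+ a b (next j)

  advance-to-top : ∀ d j → toℕ j + d ≡ top → advance d j ≡ fromℕ top
  advance-to-top zero j e = toℕ-injective (trans (sym (+-identityʳ _)) (trans e (sym (toℕ-fromℕ top))))
  advance-to-top (suc d) j e = advance-to-top d (next j) (trans (cong (_+ d) (toℕ-next j below)) (trans (sym (+-suc (toℕ j) d)) e))
    where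
    below : suc (toℕ j) < ℓ
    below = s≤s (subst (suc (toℕ j) ≤_) e (subst (_≤ toℕ j + suc d) (+-comm (toℕ j) 1) (+-monoʳ-≤ (toℕ j) (s≤s z≤n))))

  advance-from-zero : ∀ m (m<ℓ : m < ℓ) → advance m fz ≡ fromℕ< m<ℓ
  advance-from-zero zero _ = refl
  advance-from-zero (suc m) 1+m<ℓ = begin
    advance (suc m) fz        ≡⟨ advance-suc m fz ⟩
    next (advance m fz)       ≡⟨ cong next (advance-from-zero m m<ℓ) ⟩
    next (fromℕ< m<ℓ)         ≡⟨ toℕ-injective toℕ-eq ⟩
    fromℕ< 1+m<ℓ              ∎
    where
    open ≡-Reasoning
    m<ℓ : m < ℓ
    m<ℓ = <-trans (n<1+n m) 1+m<ℓ
    toℕ-eq : toℕ (next (fromℕ< m<ℓ)) ≡ toℕ (fromℕ< 1+m<ℓ)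
    toℕ-eq = trans (toℕ-next _ (subst (λ t → suc t < ℓ) (sym (toℕ-fromℕ< m<ℓ)) 1+m<ℓ))
                   (trans (cong suc (toℕ-fromℕ< m<ℓ)) (sym (toℕ-fromℕ< 1+m<ℓ)))

  -- Walk forwards from u past the top vertex, round to 0 and on to v.
  cycle-connected : Connected cycle
  cycle-connected u v = M , walk , ≡true⇒T (pathAdj-toList cycle M walk consecutive) , refl , ends
    where
    d : ℕ
    d = top ∸ toℕ u
    M : ℕ
    M = d + suc (toℕ v)
    walk : Fin (suc M) → Fin ℓ
    walk i = advance (toℕ i) u
    consecutive : (i : Fin M) → adj cycle (walk (inject₁ i)) (walk (fs i)) ≡ true
    consecutive i rewrite toℕ-inject₁ i | advance-suc (toℕ i) u = Adjacent⇒adj (inj₁ (step-next (advance (toℕ i) u)))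
    ends : walk (fromℕ M) ≡ v
    ends = begin
      advance (toℕ (fromℕ M)) u                  ≡⟨ cong (λ t → advance t u) (toℕ-fromℕ M) ⟩
      advance (d + suc (toℕ v)) u                ≡⟨ advance-+ d (suc (toℕ v)) u ⟩
      advance (suc (toℕ v)) (advance d u)        ≡⟨ cong (advance (suc (toℕ v))) (advance-to-top d u (m+[n∸m]≡n (≤-pred (toℕ<n u)))) ⟩
      advance (toℕ v) (next (fromℕ top))         ≡⟨ cong (advance (toℕ v)) next-top ⟩
      advance (toℕ v) fz                         ≡⟨ advance-from-zero (toℕ v) (toℕ<n v) ⟩
      fromℕ< (toℕ<n v)                           ≡⟨ fromℕ<-toℕ v (toℕ<n v) ⟩
      v                                          ∎
      where open ≡-Reasoning

edgeAdj : Fin 2 → Fin 2 → Bool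
edgeAdj fz (fs fz) = true
edgeAdj (fs fz) fz = true
edgeAdj _ _ = false

edgeAdj-sym : ∀ i j → edgeAdj i j ≡ edgeAdj j i
edgeAdj-sym fz fz = refl
edgeAdj-sym fz (fs fz) = refl
edgeAdj-sym (fs fz) fz = refl
edgeAdj-sym (fs fz) (fs fz) = refl

edge : Graph
edge = record { n = 2 ; adj = edgeAdj ; sym = edgeAdj-sym ; irrefl = λ { fz → refl ; (fs fz) → refl } }

edge-connected : Connected edge
edge-connected fz fz = 0 , (λ _ → fz) , tt , refl , refl
edge-connected fz (fs fz) = 1 , (fz ∷ᶠ fs fz ∷ᶠ []ᶠ) , tt , refl , refl
edge-connected (fs fz) fz = 1 , (fs fz ∷ᶠ fz ∷ᶠ []ᶠ) , tt , refl , refl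
edge-connected (fs fz) (fs fz) = 0 , (λ _ → fs fz) , tt , refl , refl

module _ (H : Graph) where

  unlabelledEdge : PLGraph H
  unlabelledEdge = record { G = edge ; τ = λ _ → nothing }

  isHom-edge : ∀ σ → isHom unlabelledEdge σ ≡ adj H (σ fz) (σ (fs fz))
  isHom-edge σ rewrite Graph.sym H (σ (fs fz)) (σ fz) with adj H (σ fz) (σ (fs fz))
  ... | true = refl
  ... | false = refl

  hom2-edge : ∀ a b → hom2 unlabelledEdge fz (fs fz) a b ≡ bool→ℕ (adj H a b)
  hom2-edge a b = begin
    hom2 unlabelledEdge fz (fs fz) a b                                      ≡⟨ count-cong as-graph (allFuns 2 (n H)) ⟩
    count (λ σ → isHom unlabelledEdge σ ∧ (g ≗ᵇ σ)) (allFuns 2 (n H))       ≡⟨ count-allFuns-at extensional g ⟩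
    bool→ℕ (isHom unlabelledEdge g)                                         ≡⟨ cong bool→ℕ (isHom-edge g) ⟩
    bool→ℕ (adj H a b)                                                      ∎
    where
    open ≡-Reasoning
    g : Fin 2 → V H
    g = a ∷ᶠ b ∷ᶠ []ᶠ
    as-graph : ∀ σ → (isHom unlabelledEdge σ ∧ ((σ fz == a) ∧ (σ (fs fz) == b))) ≡ (isHom unlabelledEdge σ ∧ (g ≗ᵇ σ))
    as-graph σ = cong (isHom unlabelledEdge σ ∧_)
      (cong₂ _∧_ (==-sym (σ fz) a) (trans (==-sym (σ (fs fz)) b) (sym (∧-identityʳ _))))
    extensional : Extensional (isHom unlabelledEdge)
    extensional {σ} {τ} σ≗τ = trans (isHom-edge σ) (trans (cong₂ (adj H) (σ≗τ fz) (σ≗τ (fs fz))) (sym (isHom-edge τ)))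

  hom2-edge-odd : ∀ {a b} → adj H a b ≡ true → Odd (hom2 unlabelledEdge fz (fs fz) a b)
  hom2-edge-odd {a} {b} a~b rewrite hom2-edge a b | a~b = refl

  hom2-edge-even : ∀ {a b} → ¬ adj H a b ≡ true → Even (hom2 unlabelledEdge fz (fs fz) a b)
  hom2-edge-even {a} {b} a≁b rewrite hom2-edge a b with adj H a b
  ... | true = ⊥-elim (a≁b refl)
  ... | false = refl

adj⇒≢ : (H : Graph) {p q : V H} → adj H p q ≡ true → ¬ p ≡ q
adj⇒≢ H {p} p~q refl with () ← trans (sym p~q) (irrefl H p)

square⇒HasCycle4 : (H : Graph) {u v x o : V H} →
  adj H u v ≡ true → adj H v x ≡ true → adj H x o ≡ true → adj H o u ≡ true →
  ¬ u ≡ x → ¬ v ≡ o → HasCycle H 4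
square⇒HasCycle4 H {u} {v} {x} {o} u~v v~x x~o o~u u≢x v≢o = (u ∷ᶠ v ∷ᶠ x ∷ᶠ o ∷ᶠ []ᶠ) , ≡true⇒T cycleSeq
  where
  cycleSeq : isCycleSeq H (u ∷ v ∷ x ∷ o ∷ []) ≡ true
  cycleSeq rewrite ==-≢ (adj⇒≢ H u~v) | ==-≢ u≢x | ==-≢ (≢-sym (adj⇒≢ H o~u))
                 | ==-≢ (adj⇒≢ H v~x) | ==-≢ v≢o | ==-≢ (adj⇒≢ H x~o)
                 | u~v | v~x | x~o | o~u = refl

module PinnedCycle (H : Graph) (k : ℕ) where
  open CycleGraph k
  open ClosedWalks H

  pinned : V H → PLGraph H
  pinned w = record { G = cycle ; τ = λ { fz → just w ; (fs _) → nothing } }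

  maps : List (Fin ℓ → V H)
  maps = allFuns ℓ (n H)

  isHom-pinned : ∀ w σ → isHom (pinned w) σ ≡ (edgeCheck cycle H σ ∧ (σ fz == w))
  isHom-pinned w σ = cong (edgeCheck cycle H σ ∧_) (trans (cong ((σ fz == w) ∧_) unlabelled) (∧-identityʳ _))
    where
    unlabelled : all (labelOK (pinned w) σ) (map fs (allFin top)) ≡ true
    unlabelled = trans (all-map (labelOK (pinned w) σ) fs (allFin top)) (all-allFin⁺ (labelOK (pinned w) σ ∘ fs) (λ _ → refl))

  Wraps : (Fin ℓ → V H) → Set
  Wraps σ = adj H (σ (fromℕ top)) (σ fz) ≡ true

  cycleHom⇒closed : ∀ {σ} → IsGraphHom cycle H σ → ConsecutivelyAdjacent H σ × Wraps σ
  cycleHom⇒closed hom =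
    (λ i → hom (inject₁ i) (fs i) (Adjacent⇒adj (inj₁ (inj₁ (cong suc (toℕ-inject₁ i)))))) ,
    hom (fromℕ top) fz (Adjacent⇒adj (inj₁ (inj₂ (toℕ-fromℕ top , refl))))

  step⇒adj : ∀ {σ i j} → ConsecutivelyAdjacent H σ × Wraps σ → Step (toℕ i) (toℕ j) → adj H (σ i) (σ j) ≡ true
  step⇒adj {j = fz} _ (inj₁ ())
  step⇒adj {σ} {j = fs j} (consecutive , _) (inj₁ e) =
    subst (λ t → adj H (σ t) (σ (fs j)) ≡ true)
          (toℕ-injective (trans (toℕ-inject₁ j) (sym (suc-injective e)))) (consecutive j)
  step⇒adj {σ} (_ , wraps) (inj₂ (i≡top , j≡0)) =
    subst₂ (λ s t → adj H (σ s) (σ t) ≡ true)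
           (toℕ-injective (trans (toℕ-fromℕ top) (sym i≡top))) (toℕ-injective {i = fz} (sym j≡0)) wraps

  closed⇒cycleHom : ∀ {σ} → ConsecutivelyAdjacent H σ × Wraps σ → IsGraphHom cycle H σ
  closed⇒cycleHom {σ} closed i j i~j with adj⇒Adjacent {i} {j} i~j
  ... | inj₁ s = step⇒adj {σ} {i} {j} closed s
  ... | inj₂ s = trans (Graph.sym H (σ i) (σ j)) (step⇒adj {σ} {j} {i} closed s)

  edgeCheck≡ClosedWalk : ∀ σ → edgeCheck cycle H σ ≡ ClosedWalk (toList σ)
  edgeCheck≡ClosedWalk σ = ⇔→≡ (mk⇔
    (λ e → let consecutive , wraps = cycleHom⇒closed {σ} (edgeCheck⇒IsGraphHom cycle H e)
           in pathAdj-toList-∷ʳ⁺ H top σ (σ fz) consecutive wraps)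
    (λ e → IsGraphHom⇒edgeCheck cycle H (closed⇒cycleHom {σ} (pathAdj-toList-∷ʳ⁻ H top σ (σ fz) e))))

  module _ (odd : parity ℓ ≡ true) (no-shorter : ∀ j → OddN j → j < ℓ → ¬ HasCycle H j) where

    closedWalk⇒distinct : ∀ σ → (distinct (toList σ) ∧ ClosedWalk (toList σ)) ≡ ClosedWalk (toList σ)
    closedWalk⇒distinct σ with ClosedWalk (toList σ) in closed
    ... | true = cong (_∧ true) (closed-walk-of-odd-girth-is-distinct no-shorter (toList σ) (length-tabulate σ)
                   (closed , subst (λ t → parity t ≡ true) (sym (length-tabulate σ)) odd))
    ... | false = ∧-zeroʳ _

    cyclesThrough≡hom1 : ∀ a b → cyclesThrough H a b ℓ ≡ hom1 (pinned a) (fs fz) b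
    cyclesThrough≡hom1 a b = count-cong as-hom maps
      where
      as-hom : ∀ σ → (startsWith a b (toList σ) ∧ isCycleSeq H (toList σ)) ≡ (isHom (pinned a) σ ∧ (σ (fs fz) == b))
      as-hom σ = begin
        ((σ fz == a) ∧ (σ (fs fz) == b)) ∧ (distinct (toList σ) ∧ ClosedWalk (toList σ))
          ≡⟨ cong (((σ fz == a) ∧ (σ (fs fz) == b)) ∧_) (trans (closedWalk⇒distinct σ) (sym (edgeCheck≡ClosedWalk σ))) ⟩
        ((σ fz == a) ∧ (σ (fs fz) == b)) ∧ edgeCheck cycle H σ
          ≡⟨ ∧-comm ((σ fz == a) ∧ (σ (fs fz) == b)) _ ⟩
        edgeCheck cycle H σ ∧ ((σ fz == a) ∧ (σ (fs fz) == b))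
          ≡⟨ ∧-assoc (edgeCheck cycle H σ) _ _ ⟨
        (edgeCheck cycle H σ ∧ (σ fz == a)) ∧ (σ (fs fz) == b)
          ≡⟨ cong (_∧ (σ (fs fz) == b)) (isHom-pinned a σ) ⟨
        isHom (pinned a) σ ∧ (σ (fs fz) == b) ∎
        where open ≡-Reasoning

  homThrough : V H → V H → (Fin ℓ → V H) → Bool
  homThrough a b σ = (edgeCheck cycle H σ ∧ (σ fz == a)) ∧ (σ (fs fz) == b)

  hom1≡count-homThrough : ∀ a b → hom1 (pinned a) (fs fz) b ≡ count (homThrough a b) maps
  hom1≡count-homThrough a b = count-cong (λ σ → cong (_∧ (σ (fs fz) == b)) (isHom-pinned a σ)) maps

  homThrough-extensional : ∀ a b → Extensional (homThrough a b)
  homThrough-extensional a b σ≗τ =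
    cong₂ _∧_ (cong₂ _∧_ (edgeCheck-extensional cycle H σ≗τ) (cong (_== a) (σ≗τ fz))) (cong (_== b) (σ≗τ (fs fz)))

  homThrough-Swap₀₁ : ∀ a b σ → homThrough a b (σ ∘ Swap₀₁.reflect) ≡ homThrough b a σ
  homThrough-Swap₀₁ a b σ = begin
    (edgeCheck cycle H (σ ∘ Swap₀₁.reflect) ∧ (σ (Swap₀₁.reflect fz) == a)) ∧ (σ (Swap₀₁.reflect (fs fz)) == b)
      ≡⟨ cong₂ _∧_ (cong₂ _∧_ reflected-edges (cong (λ i → σ i == a) reflect-0)) (cong (λ i → σ i == b) reflect-1) ⟩
    (edgeCheck cycle H σ ∧ (σ (fs fz) == a)) ∧ (σ fz == b)
      ≡⟨ ∧-assoc (edgeCheck cycle H σ) (σ (fs fz) == a) (σ fz == b) ⟩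
    edgeCheck cycle H σ ∧ ((σ (fs fz) == a) ∧ (σ fz == b))
      ≡⟨ cong (edgeCheck cycle H σ ∧_) (∧-comm (σ (fs fz) == a) (σ fz == b)) ⟩
    edgeCheck cycle H σ ∧ ((σ fz == b) ∧ (σ (fs fz) == a))
      ≡⟨ ∧-assoc (edgeCheck cycle H σ) (σ fz == b) (σ (fs fz) == a) ⟨
    (edgeCheck cycle H σ ∧ (σ fz == b)) ∧ (σ (fs fz) == a) ∎
    where
    open ≡-Reasoning
    reflected-edges : edgeCheck cycle H (σ ∘ Swap₀₁.reflect) ≡ edgeCheck cycle H σ
    reflected-edges = edgeCheck-∘-involution cycle H Swap₀₁.reflect Swap₀₁.reflect-isGraphHom Swap₀₁.reflect-involutive σ
    reflect-0 : Swap₀₁.reflect fz ≡ fs fz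
    reflect-0 = toℕ-injective (Swap₀₁.toℕ-reflect fz (inj₁ (z≤n , refl)))
    reflect-1 : Swap₀₁.reflect (fs fz) ≡ fz
    reflect-1 = toℕ-injective (Swap₀₁.toℕ-reflect (fs fz) (inj₁ (≤-refl , refl)))

  hom1-pinned-sym : ∀ a b → hom1 (pinned a) (fs fz) b ≡ hom1 (pinned b) (fs fz) a
  hom1-pinned-sym a b = begin
    hom1 (pinned a) (fs fz) b                              ≡⟨ hom1≡count-homThrough a b ⟩
    count (homThrough a b) maps                            ≡⟨ count-allFuns-∘ (homThrough-extensional a b)
                                                                 Swap₀₁.reflect Swap₀₁.reflect
                                                                 Swap₀₁.reflect-involutive Swap₀₁.reflect-involutive ⟩
    count (λ σ → homThrough a b (σ ∘ Swap₀₁.reflect)) maps ≡⟨ count-cong (homThrough-Swap₀₁ a b) maps ⟩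
    count (homThrough b a) maps                            ≡⟨ hom1≡count-homThrough b a ⟨
    hom1 (pinned b) (fs fz) a                              ∎
    where open ≡-Reasoning

  -- The reflection fixing 0 is a fixed-point-free involution on the homomorphisms: it would have to
  -- identify the ends of the edge it flips.
  count-homs-pinned-even : parity ℓ ≡ true → ∀ w → parity (count (isHom (pinned w)) maps) ≡ false
  count-homs-pinned-even odd w =
    trans (cong parity (count-cong (isHom-pinned w) maps))
          (count-allFuns-even extensional Fix₀.reflect Fix₀.reflect-involutive invariant no-fixpoint)
    where
    extensional : Extensional (λ σ → edgeCheck cycle H σ ∧ (σ fz == w))
    extensional σ≗τ = cong₂ _∧_ (edgeCheck-extensional cycle H σ≗τ) (cong (_== w) (σ≗τ fz))
    reflect-0 : Fix₀.reflect fz ≡ fz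
    reflect-0 = toℕ-injective (Fix₀.toℕ-reflect fz (inj₁ (z≤n , refl)))
    invariant : ∀ σ → (edgeCheck cycle H (σ ∘ Fix₀.reflect) ∧ (σ (Fix₀.reflect fz) == w)) ≡ (edgeCheck cycle H σ ∧ (σ fz == w))
    invariant σ = cong₂ _∧_ (edgeCheck-∘-involution cycle H Fix₀.reflect Fix₀.reflect-isGraphHom Fix₀.reflect-involutive σ)
                            (cong (λ i → σ i == w) reflect-0)
    no-fixpoint : ∀ σ → (edgeCheck cycle H σ ∧ (σ fz == w)) ≡ true → ¬ (∀ i → σ i ≡ σ (Fix₀.reflect i))
    no-fixpoint σ hom fixed = adj⇒≢ H σm~σρm (fixed m)
      where
      m : Fin ℓ
      m = proj₁ (Fix₀-flips-edge odd)
      σm~σρm : adj H (σ m) (σ (Fix₀.reflect m)) ≡ true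
      σm~σρm = edgeCheck⇒IsGraphHom cycle H (∧-conicalˡ (edgeCheck cycle H σ) (σ fz == w) hom) m (Fix₀.reflect m)
                 (Adjacent⇒adj {m} {Fix₀.reflect m} (proj₂ (Fix₀-flips-edge odd)))

  hom1-pinned-odd⇒adj : ∀ {w o} → Odd (hom1 (pinned w) (fs fz) o) → adj H w o ≡ true
  hom1-pinned-odd⇒adj {w} {o} odd
    with count>0⇒∃ maps (subst (0 <_) (hom1≡count-homThrough w o) (Odd⇒>0 odd))
  ... | σ , through = subst₂ (λ x y → adj H x y ≡ true) (==⇒≡ σ0=w) (==⇒≡ σ1=o)
                        (edgeCheck⇒IsGraphHom cycle H hom fz (fs fz) (Adjacent⇒adj {fz} {fs fz} (inj₁ (inj₁ refl))))
    where
    pinned-hom : (edgeCheck cycle H σ ∧ (σ fz == w)) ≡ true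
    pinned-hom = ∧-conicalˡ (edgeCheck cycle H σ ∧ (σ fz == w)) (σ (fs fz) == o) through
    hom : edgeCheck cycle H σ ≡ true
    hom = ∧-conicalˡ (edgeCheck cycle H σ) (σ fz == w) pinned-hom
    σ0=w : (σ fz == w) ≡ true
    σ0=w = ∧-conicalʳ (edgeCheck cycle H σ) (σ fz == w) pinned-hom
    σ1=o : (σ (fs fz) == o) ≡ true
    σ1=o = ∧-conicalʳ (edgeCheck cycle H σ ∧ (σ fz == w)) (σ (fs fz) == o) through

module _ (H : Graph) (k : ℕ) (square-free : SquareFree H)
         (odd : parity (suc (suc (suc k))) ≡ true)
         (no-shorter : ∀ j → OddN j → j < suc (suc (suc k)) → ¬ HasCycle H j) where
  open CycleGraph k
  open PinnedCycle H k

  pinnedCycleGadget : ∀ {u v} → adj H u v ≡ true → Odd (cyclesThrough H u v ℓ) → HardnessGadget H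
  pinnedCycleGadget {u} {v} u~v odd-cycles = record
    { i = v ; s = u ; J₁ = pinned u ; J₂ = pinned v ; J₃ = unlabelledEdge H
    ; y₁ = fs fz ; z₂ = fs fz ; y₃ = fz ; z₃ = fs fz
    ; conn₁ = cycle-connected ; conn₂ = cycle-connected ; conn₃ = edge-connected
    ; Ωy-even = Ω-even u
    ; i∈Ωy = subst Odd (cyclesThrough≡hom1 odd no-shorter u v) odd-cycles
    ; Ωz-even = Ω-even v
    ; s∈Ωz = subst Odd (trans (cyclesThrough≡hom1 odd no-shorter u v) (hom1-pinned-sym u v)) odd-cycles
    ; cond3 = λ o x o∈Ωy o≢v x∈Ωz x≢u → hom2-edge-even H λ o~x →
        square-free (square⇒HasCycle4 H u~v (hom1-pinned-odd⇒adj x∈Ωz) (adj-sym o~x)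
                       (adj-sym (hom1-pinned-odd⇒adj o∈Ωy)) (≢-sym x≢u) (≢-sym o≢v))
    ; cond4-is = hom2-edge-odd H (adj-sym u~v)
    ; cond4-os = λ o o∈Ωy _ → hom2-edge-odd H (adj-sym (hom1-pinned-odd⇒adj o∈Ωy))
    ; cond4-ix = λ x x∈Ωz _ → hom2-edge-odd H (hom1-pinned-odd⇒adj x∈Ωz)
    }
    where
    adj-sym : ∀ {a b} → adj H a b ≡ true → adj H b a ≡ true
    adj-sym {a} {b} = trans (Graph.sym H b a)
    Ω-even : ∀ w → Even (omegaSize (pinned w) (fs fz))
    Ω-even w = parity⇒Even (omegaSize (pinned w) (fs fz))
                 (trans (omegaSize-parity (pinned w) (fs fz)) (count-homs-pinned-even odd w))

lemma5p12 : (H : Graph) (ℓ : ℕ) → SquareFree H → OddGirth H ℓ →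
            Σ (V H) (λ u → Σ (V H) (λ v → (adj H u v ≡ true) × Odd (cyclesThrough H u v ℓ))) →
            HardnessGadget H
lemma5p12 H zero _ (() , _) _
lemma5p12 H (suc zero) _ (_ , (_ , ()) , _) _
lemma5p12 H (suc (suc zero)) _ (ss () , _) _
lemma5p12 H (suc (suc (suc k))) square-free (odd , _ , no-shorter) (u , v , u~v , odd-cycles) =
  pinnedCycleGadget H k square-free (OddN⇒parity odd) no-shorter u~v odd-cycles
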